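{- The only points $(X,Y)$ with $X\in\mathbb{Q}$ and $Y\in\mathbb{Q}(\sqrt{2})$ on the curve $$\mathcal{C}_{\pi/4,\pi/2}:\quad X^4-\sqrt{2}\,X^3+2X^2-\sqrt{2}\,X+1=Y^2$$ are $(X,Y)=(0,\pm 1)$. Consequently there are no positive integers $x,y$ for which both $\sqrt{x^2-\sqrt{2}\,xy+y^2}$ and $\sqrt{x^2+y^2}$ lie in $\mathbb{Q}(\sqrt{2})$.
   Context: The curve arises from the equations $x^2-2\cos(\pi/4)xy+y^2=z_1^2$ and $x^2+y^2=z_2^2$ (law of cosines for triangles with two integer sides $x,y$ enclosing angles $\pi/4$ and $\pi/2$, with opposite sides $z_1,z_2\in\mathbb{Q}(\sqrt2)$) by multiplying them and setting $X=x/y$, $Y=z_1z_2/y^2$. -}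

module Defs where

open import Data.Nat using (ℕ)
open import Data.Integer using (+_)
import Data.Rational as Q
open Q using (ℚ; 0ℚ; 1ℚ)

-- The quadratic field ℚ(√2): elements a + b√2 with a b ∈ ℚ,
-- represented by their (unique) coordinates in the ℚ-basis {1, √2}.
record ℚ√2 : Set where
  constructor _+_√2
  field
    re : ℚ
    im : ℚ
open ℚ√2 public

infixl 6 _⊕_ _⊖_
infixl 7 _⊛_

_⊕_ : ℚ√2 → ℚ√2 → ℚ√2
(a + b √2) ⊕ (c + d √2) = (a Q.+ c) + (b Q.+ d) √2

⊝_ : ℚ√2 → ℚ√2
⊝ (a + b √2) = (Q.- a) + (Q.- b) √2

_⊖_ : ℚ√2 → ℚ√2 → ℚ√2
x ⊖ y = x ⊕ (⊝ y)

-- (a + b√2)(c + d√2) = (ac + 2bd) + (ad + bc)√2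
_⊛_ : ℚ√2 → ℚ√2 → ℚ√2
(a + b √2) ⊛ (c + d √2) =
  (a Q.* c Q.+ (+ 2 Q./ 1) Q.* (b Q.* d)) + (a Q.* d Q.+ b Q.* c) √2

ι : ℚ → ℚ√2
ι q = q + 0ℚ √2

ιℕ : ℕ → ℚ√2
ιℕ n = ι (+ n Q./ 1)

√2 : ℚ√2
√2 = 0ℚ + 1ℚ √2

𝟙 : ℚ√2
𝟙 = ι 1ℚ

curveRHS : ℚ√2 → ℚ√2
curveRHS X =
  X ⊛ X ⊛ X ⊛ X ⊖ √2 ⊛ (X ⊛ X ⊛ X) ⊕ ιℕ 2 ⊛ (X ⊛ X) ⊖ √2 ⊛ X ⊕ 𝟙

OnCurve : ℚ → ℚ√2 → Set
OnCurve X Y = Y ⊛ Y ≡ curveRHS (ι X)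
  where open import Relation.Binary.PropositionalEquality using (_≡_)

-- The norm N(a + b√2) = a² − 2b² of ℚ(√2) is multiplicative. A point (X, Y) of the curve
-- therefore gives N(Y)² = N(X⁴ − √2X³ + 2X² − √2X + 1) = (X² + 1)²(X⁴ + 1), and a side z₁
-- with z₁² = x² − √2xy + y² gives N(z₁)² = (x² + y²)² − 2x²y² = x⁴ + y⁴. Both are rational
-- points on w² = p⁴ + q⁴ with p, q ≠ 0 (for X ≠ 0 take p = X(X² + 1), q = X² + 1), and clearing
-- denominators turns them into solutions of Fermat's x⁴ + y⁴ = z², which has none by infinite
-- descent through primitive Pythagorean triples. For X = 0 the equation reads Y² = 1, and the
-- irrationality of √2 leaves only Y = ±1.
module Submission where

open import Defs
open import Data.Nat using (ℕ; _≥_)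
open import Data.Product using (_×_; ∃)
open import Data.Sum using (_⊎_)
open import Relation.Binary.PropositionalEquality using (_≡_)
open import Relation.Nullary using (¬_)
open import Data.Rational using (ℚ; 0ℚ)

module FermatQuartic where

  open import Data.Nat.Base hiding (parity)
  open import Data.Nat.Properties
  open import Data.Nat.Divisibility
  open import Data.Nat.GCD using (gcd; gcd[m,n]∣m; gcd[m,n]∣n; gcd[m,n]≢0)
  open import Data.Nat.Coprimality as Coprime using (Coprime; coprime-divisor; coprime-/gcd)
  open import Data.Nat.Induction using (<-rec)
  open import Data.Nat.Tactic.RingSolver using (solve; solve-∀)
  open import Data.List.Base using (_∷_; [])
  open import Data.Product using (∃-syntax; ∃₂; _,_)
  open import Data.Sum using (inj₂)
  open import Relation.Binary.PropositionalEquality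
  open import Relation.Nullary using (yes; no; contradiction)

  IsSquare : ℕ → Set
  IsSquare n = ∃[ s ] s * s ≡ n

  Odd : ℕ → Set
  Odd n = ∃[ i ] n ≡ 1 + 2 * i

  data Parity : ℕ → Set where
    even : ∀ k → Parity (2 * k)
    odd  : ∀ k → Parity (1 + 2 * k)

  parity : ∀ n → Parity n
  parity zero = even 0
  parity (suc n) with parity n
  ... | even k = odd k
  ... | odd k = subst Parity (cong suc (+-suc k (k + 0))) (even (suc k))

  square-cancel-≤ : ∀ {m n} → m * m ≤ n * n → m ≤ n
  square-cancel-≤ {m} {n} m²≤n² with m ≤? n
  ... | yes m≤n = m≤n
  ... | no m≰n = contradiction m²≤n² (<⇒≱ (*-mono-< n<m n<m))
    where n<m = ≰⇒> m≰n

  square-injective : ∀ {m n} → m * m ≡ n * n → m ≡ n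
  square-injective eq =
    ≤-antisym (square-cancel-≤ (≤-reflexive eq)) (square-cancel-≤ (≤-reflexive (sym eq)))

  n≤n*n : ∀ n → n ≤ n * n
  n≤n*n zero = z≤n
  n≤n*n (suc n) = m≤m*n (suc n) (suc n)

  coprime-∣ˡ : ∀ {d m n} → d ∣ m → Coprime m n → Coprime d n
  coprime-∣ˡ d∣m cop (e∣d , e∣n) = cop (∣-trans e∣d d∣m , e∣n)

  coprime-∣ʳ : ∀ {d m n} → d ∣ n → Coprime m n → Coprime m d
  coprime-∣ʳ d∣n cop (e∣m , e∣d) = cop (e∣m , ∣-trans e∣d d∣n)

  coprime-*ʳ : ∀ {m n o} → Coprime m n → Coprime m o → Coprime m (n * o)
  coprime-*ʳ cop-n cop-o (d∣m , d∣no) =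
    cop-o (d∣m , coprime-divisor (coprime-∣ˡ d∣m cop-n) d∣no)

  coprime-square : ∀ {m n} → Coprime m n → Coprime (m * m) (n * n)
  coprime-square cop = Coprime.sym (coprime-*ʳ n-m² n-m²)
    where n-m² = Coprime.sym (coprime-*ʳ cop cop)

  coprime-unsquare : ∀ {m n} → Coprime (m * m) (n * n) → Coprime m n
  coprime-unsquare {m} {n} cop (d∣m , d∣n) = cop (∣m⇒∣m*n m d∣m , ∣m⇒∣m*n n d∣n)

  gcd-decomposition : ∀ m n → n ≢ 0 →
    ∃[ g ] ∃₂ λ a b → g ≢ 0 × m ≡ a * g × n ≡ b * g × Coprime a b
  gcd-decomposition m n n≢0 =
    g , quotient g∣m , quotient g∣n , g≢0 ,
    m∣n⇒n≡quotient*m g∣m , m∣n⇒n≡quotient*m g∣n ,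
    subst₂ Coprime (n/m≡quotient g∣m) (n/m≡quotient g∣n) (coprime-/gcd m n)
    where
    g = gcd m n
    g≢0 = gcd[m,n]≢0 m n (inj₂ n≢0)
    instance
      _ : NonZero g
      _ = ≢-nonZero g≢0
    g∣m = gcd[m,n]∣m m n
    g∣n = gcd[m,n]∣n m n

  coprime-factor-square : ∀ {u v} → Coprime u v → IsSquare (u * v) → IsSquare u
  coprime-factor-square {u} {v} cop (w , w²≡uv) with u ≟ 0
  ... | yes refl = 0 , refl
  ... | no u≢0 with gcd-decomposition w u u≢0
  ... | g , b , a , g≢0 , refl , refl , coprime-ba = a , cong (a *_) g≡a
    where
    instance
      _ : NonZero g
      _ = ≢-nonZero g≢0
      _ : NonZero a
      _ = ≢-nonZero (λ a≡0 → u≢0 (cong (_* g) a≡0))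
    open ≡-Reasoning
    av≡bbg : a * v ≡ b * b * g
    av≡bbg = *-cancelʳ-≡ _ _ g (begin
      a * v * g         ≡⟨ solve (a ∷ v ∷ g ∷ []) ⟩
      a * g * v         ≡⟨ w²≡uv ⟨
      b * g * (b * g)   ≡⟨ solve (b ∷ g ∷ []) ⟩
      b * b * g * g     ∎)
    a∣g : a ∣ g
    a∣g = coprime-divisor coprime-ab (coprime-divisor coprime-ab
            (subst (a ∣_) (trans av≡bbg (*-assoc b b g)) (m∣m*n v)))
      where coprime-ab = Coprime.sym coprime-ba
    k = quotient a∣g
    v≡bbk : v ≡ b * b * k
    v≡bbk = *-cancelˡ-≡ _ _ a (begin
      a * v             ≡⟨ av≡bbg ⟩
      b * b * g         ≡⟨ cong (b * b *_) (m∣n⇒n≡quotient*m a∣g) ⟩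
      b * b * (k * a)   ≡⟨ *-assoc (b * b) k a ⟨
      b * b * k * a     ≡⟨ *-comm (b * b * k) a ⟩
      a * (b * b * k)   ∎)
    k≡1 : k ≡ 1
    k≡1 = cop (∣n⇒∣m*n a (quotient-∣ a∣g) , subst (k ∣_) (sym v≡bbk) (n∣m*n (b * b)))
    g≡a : a ≡ g
    g≡a = begin
      a                 ≡⟨ *-identityˡ a ⟨
      1 * a             ≡⟨ cong (_* a) k≡1 ⟨
      k * a             ≡⟨ m∣n⇒n≡quotient*m a∣g ⟨
      g                 ∎

  coprime-product-square : ∀ {u v} → Coprime u v → IsSquare (u * v) → IsSquare u × IsSquare v
  coprime-product-square {u} {v} cop (w , w²≡uv) =
    coprime-factor-square cop (w , w²≡uv) ,
    coprime-factor-square (Coprime.sym cop) (w , trans w²≡uv (*-comm u v))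

  square-cancelˡ : ∀ {b n} → b ≢ 0 → IsSquare (b * b * n) → IsSquare n
  square-cancelˡ {b} {n} b≢0 (A , A²≡b²n) with gcd-decomposition A b b≢0
  ... | g , a , c , g≢0 , refl , refl , coprime-ac = a , trans a²≡c²n c²n≡n
    where
    instance
      _ : NonZero (g * g)
      _ = ≢-nonZero (λ g²≡0 → g≢0 (m*n≡0⇒m≡0 g g {{≢-nonZero g≢0}} g²≡0))
    open ≡-Reasoning
    a²≡c²n : a * a ≡ c * c * n
    a²≡c²n = *-cancelʳ-≡ _ _ (g * g) (begin
      a * a * (g * g)         ≡⟨ solve (a ∷ g ∷ []) ⟩
      a * g * (a * g)         ≡⟨ A²≡b²n ⟩
      c * g * (c * g) * n     ≡⟨ solve (c ∷ g ∷ n ∷ []) ⟩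
      c * c * n * (g * g)     ∎)
    c≡1 : c ≡ 1
    c≡1 = coprime-ac (coprime-divisor (Coprime.sym coprime-ac)
                       (subst (c ∣_) (sym a²≡c²n) (∣m⇒∣m*n n (m∣m*n c))) , ∣-refl)
    c²n≡n : c * c * n ≡ n
    c²n≡n = trans (cong (λ c → c * c * n) c≡1) (+-identityʳ n)

  odd-square : ∀ i → (1 + 2 * i) * (1 + 2 * i) ≡ 1 + 2 * (2 * (i * i + i))
  odd-square = solve-∀

  odd-squares-sum : ∀ i j →
    (1 + 2 * i) * (1 + 2 * i) + (1 + 2 * j) * (1 + 2 * j) ≡ 2 * (1 + 2 * (i * i + i + (j * j + j)))
  odd-squares-sum = solve-∀

  -- A sum of two odd squares is 2 modulo 4, while squares are 0 or 1 modulo 4.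
  odd-squares-sum-not-square : ∀ i j c →
    (1 + 2 * i) * (1 + 2 * i) + (1 + 2 * j) * (1 + 2 * j) ≢ c * c
  odd-squares-sum-not-square i j c eq with parity c
  ... | even k = even≢odd (k * k) q (*-cancelˡ-≡ _ _ 2 (begin
    2 * (2 * (k * k))          ≡⟨ solve (k ∷ []) ⟩
    2 * k * (2 * k)            ≡⟨ eq ⟨
    _                          ≡⟨ odd-squares-sum i j ⟩
    2 * (1 + 2 * q)            ∎))
    where
    open ≡-Reasoning
    q = i * i + i + (j * j + j)
  ... | odd k = even≢odd (1 + 2 * q) (2 * (k * k + k)) (begin
    2 * (1 + 2 * q)            ≡⟨ odd-squares-sum i j ⟨
    _                          ≡⟨ eq ⟩
    (1 + 2 * k) * (1 + 2 * k)  ≡⟨ odd-square k ⟩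
    1 + 2 * (2 * (k * k + k))  ∎)
    where
    open ≡-Reasoning
    q = i * i + i + (j * j + j)

  coprime-hypotenuse : ∀ {a b c} → Coprime a b → a * a + b * b ≡ c * c → Coprime a c
  coprime-hypotenuse {a} {b} {c} cop eq {d} (d∣a , d∣c) = cop (d∣a , d∣b)
    where
    d∣b² : d ∣ b * b
    d∣b² = ∣m+n∣m⇒∣n (subst (d ∣_) (sym eq) (∣m⇒∣m*n c d∣c)) (∣m⇒∣m*n a d∣a)
    d∣b = coprime-divisor (coprime-∣ˡ d∣a cop) d∣b²

  coprime-legs : ∀ {a b c} → Coprime c b → a * a + b * b ≡ c * c → Coprime a b
  coprime-legs {a} {b} {c} cop eq {d} (d∣a , d∣b) = cop (d∣c , d∣b)
    where
    d∣c² : d ∣ c * c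
    d∣c² = subst (d ∣_) eq (∣m∣n⇒∣m+n (∣m⇒∣m*n a d∣a) (∣m⇒∣m*n b d∣b))
    d∣c = coprime-divisor (coprime-∣ˡ d∣b (Coprime.sym cop)) d∣c²

  -- Writing c = a + 2q, the equation becomes (a + q) q = b² with a + q and q coprime.
  primitive-pythagorean-triple : ∀ {a b c} → Odd a → Coprime a (2 * b) →
    a * a + 2 * b * (2 * b) ≡ c * c →
    ∃₂ λ m n → Coprime m n × a + n * n ≡ m * m × b ≡ m * n × c ≡ m * m + n * n
  primitive-pythagorean-triple {a} {b} {c} (i , refl) cop eq with parity c
  ... | even k = contradiction (begin
    2 * (2 * (k * k))                    ≡⟨ solve (k ∷ []) ⟩
    2 * k * (2 * k)                      ≡⟨ eq ⟨
    a * a + 2 * b * (2 * b)              ≡⟨ solve (i ∷ b ∷ []) ⟩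
    1 + 2 * (2 * (i * i + i + b * b))    ∎) (even≢odd (2 * (k * k)) (2 * (i * i + i + b * b)))
    where open ≡-Reasoning
  ... | odd j with m≤n⇒∃[o]m+o≡n i≤j
    where
    i≤j : i ≤ j
    i≤j = *-cancelˡ-≤ 2 (+-cancelˡ-≤ 1 _ _ (square-cancel-≤ (subst (a * a ≤_) eq (m≤m+n (a * a) _))))
  ... | q , refl = conclude (coprime-product-square coprime-a+q,q (b , sym a+q*q≡b²))
    where
    open ≡-Reasoning
    c≡a+q+q : 1 + 2 * (i + q) ≡ a + q + q
    c≡a+q+q = solve (i ∷ q ∷ [])
    a+q*q≡b² : (a + q) * q ≡ b * b
    a+q*q≡b² = *-cancelˡ-≡ _ _ 4 (+-cancelˡ-≡ (a * a) _ _ (begin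
      a * a + 4 * ((a + q) * q)                  ≡⟨ solve (i ∷ q ∷ []) ⟩
      (1 + 2 * (i + q)) * (1 + 2 * (i + q))      ≡⟨ eq ⟨
      a * a + 2 * b * (2 * b)                    ≡⟨ solve (i ∷ b ∷ []) ⟩
      a * a + 4 * (b * b)                        ∎))
    coprime-a+q,q : Coprime (a + q) q
    coprime-a+q,q {d} (d∣a+q , d∣q) = coprime-hypotenuse cop eq (d∣a , d∣c)
      where
      d∣a = ∣m+n∣m⇒∣n (subst (d ∣_) (+-comm a q) d∣a+q) d∣q
      d∣c = subst (d ∣_) (sym c≡a+q+q) (∣m∣n⇒∣m+n d∣a+q d∣q)
    conclude : IsSquare (a + q) × IsSquare q →
      ∃₂ λ m n → Coprime m n × a + n * n ≡ m * m × b ≡ m * n × 1 + 2 * (i + q) ≡ m * m + n * n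
    conclude ((m , m²≡a+q) , (n , n²≡q)) =
      m , n ,
      coprime-unsquare (subst₂ Coprime (sym m²≡a+q) (sym n²≡q) coprime-a+q,q) ,
      trans (cong (a +_) n²≡q) (sym m²≡a+q) ,
      square-injective (begin
        b * b                 ≡⟨ a+q*q≡b² ⟨
        (a + q) * q           ≡⟨ cong₂ _*_ m²≡a+q n²≡q ⟨
        m * m * (n * n)       ≡⟨ [m*n]*[o*p]≡[m*o]*[n*p] m m n n ⟩
        m * n * (m * n)       ∎) ,
      trans c≡a+q+q (sym (cong₂ _+_ m²≡a+q n²≡q))

  Quartic : ℕ → ℕ → ℕ → Set
  Quartic x y z = x * x * (x * x) + y * y * (y * y) ≡ z * z

  record PrimitiveSolution (z : ℕ) : Set where
    constructor solution
    field
      {x y}   : ℕ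
      x≢0     : x ≢ 0
      y≢0     : y ≢ 0
      coprime : Coprime x y
      quartic : Quartic x y z

  -- (x², y², z) is a primitive Pythagorean triple; x² + n² = m² with x odd forces n = 2t.
  quartic-pythagorean : ∀ {x k z} → Odd x → Coprime x (2 * k) → Quartic x (2 * k) z →
    ∃₂ λ m t → Coprime m (2 * t) × x * x + 2 * t * (2 * t) ≡ m * m × k * k ≡ m * t ×
               z ≡ m * m + 2 * t * (2 * t)
  quartic-pythagorean {x} {k} {z} (i , refl) cop eq
    with primitive-pythagorean-triple odd-x² (subst (Coprime (x * x)) y²≡4k² (coprime-square cop))
           (trans (cong (λ u → x * x * (x * x) + u * u) (sym y²≡4k²)) eq)
    where
    odd-x² : Odd (x * x)
    odd-x² = 2 * (i * i + i) , odd-square i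
    y²≡4k² : 2 * k * (2 * k) ≡ 2 * (2 * (k * k))
    y²≡4k² = solve (k ∷ [])
  ... | m , n , coprime-mn , x²+n²≡m² , 2k²≡mn , z≡m²+n² with parity n
  ...   | odd t = contradiction x²+n²≡m² (odd-squares-sum-not-square i t m)
  ...   | even t = m , t , coprime-mn , x²+n²≡m² , k²≡mt , z≡m²+n²
    where
    k²≡mt : k * k ≡ m * t
    k²≡mt = *-cancelˡ-≡ _ _ 2 (trans 2k²≡mn (solve (m ∷ t ∷ [])))

  -- With t = r s and m = r² + s², the pairwise coprime m, r, s multiply to k², so all three
  -- are squares: m = γ², r = α², s = β², and then α⁴ + β⁴ = γ².
  descent-from-triple : ∀ {x k m t} → Odd x → k ≢ 0 → Coprime m (2 * t) →
    x * x + 2 * t * (2 * t) ≡ m * m → k * k ≡ m * t → ∃[ γ ] γ * γ ≡ m × PrimitiveSolution γ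
  descent-from-triple {x} {k} {m} {t} odd-x k≢0 coprime-m2t eq k²≡mt
    with primitive-pythagorean-triple odd-x (coprime-legs coprime-m2t eq) eq
  ... | r , s , coprime-rs , _ , t≡rs , m≡r²+s²
    with coprime-product-square (coprime-∣ʳ (n∣m*n 2) coprime-m2t) (k , k²≡mt)
  ... | (γ , γ²≡m) , square-t
    with coprime-product-square coprime-rs (subst IsSquare t≡rs square-t)
  ... | (α , α²≡r) , (β , β²≡s) =
    γ , γ²≡m , solution α≢0 β≢0 coprime-αβ quartic
    where
    coprime-αβ : Coprime α β
    coprime-αβ = coprime-unsquare (subst₂ Coprime (sym α²≡r) (sym β²≡s) coprime-rs)
    quartic : Quartic α β γ
    quartic = trans (cong₂ (λ u v → u * u + v * v) α²≡r β²≡s) (trans (sym m≡r²+s²) (sym γ²≡m))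
    t≡0⇒k≡0 : t ≡ 0 → k ≡ 0
    t≡0⇒k≡0 t≡0 = m*n≡0⇒m≡0 k k {{≢-nonZero k≢0}} (trans k²≡mt (trans (cong (m *_) t≡0) (*-zeroʳ m)))
    α≢0 : α ≢ 0
    α≢0 refl = k≢0 (t≡0⇒k≡0 (trans t≡rs (cong (_* s) (sym α²≡r))))
    β≢0 : β ≢ 0
    β≢0 refl = k≢0 (t≡0⇒k≡0 (trans t≡rs (trans (cong (r *_) (sym β²≡s)) (*-zeroʳ r))))

  descent-odd-even : ∀ {x k z} → Odd x → k ≢ 0 → Coprime x (2 * k) → Quartic x (2 * k) z →
    ∃[ z' ] z' < z × PrimitiveSolution z'
  descent-odd-even {x} {k} {z} odd-x k≢0 cop eq with quartic-pythagorean {k = k} odd-x cop eq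
  ... | m , t , coprime-m2t , x²+4t²≡m² , k²≡mt , z≡m²+4t²
    with descent-from-triple odd-x k≢0 coprime-m2t x²+4t²≡m² k²≡mt
  ... | γ , γ²≡m , smaller = γ , γ<z , smaller
    where
    t≢0 : t ≢ 0
    t≢0 refl = k≢0 (m*n≡0⇒m≡0 k k {{≢-nonZero k≢0}} (trans k²≡mt (*-zeroʳ m)))
    instance
      _ : NonZero t
      _ = ≢-nonZero t≢0
      _ : NonZero (2 * t)
      _ = m*n≢0 2 t
      _ : NonZero (2 * t * (2 * t))
      _ = m*n≢0 (2 * t) (2 * t)
    open ≤-Reasoning
    γ<z : γ < z
    γ<z = begin-strict
      γ                         ≤⟨ n≤n*n γ ⟩
      γ * γ                     ≡⟨ γ²≡m ⟩
      m                         ≤⟨ n≤n*n m ⟩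
      m * m                     <⟨ m<m+n (m * m) (>-nonZero⁻¹ _) ⟩
      m * m + 2 * t * (2 * t)   ≡⟨ z≡m²+4t² ⟨
      z                         ∎

  descent : ∀ {z} → PrimitiveSolution z → ∃[ z' ] z' < z × PrimitiveSolution z'
  descent {z} (solution {x} {y} x≢0 y≢0 cop eq) with parity x | parity y
  ... | even i | even j = contradiction (cop (m∣m*n {2} i , m∣m*n j)) λ ()
  ... | odd i  | odd j  =
    contradiction (trans (sym (cong₂ (λ u v → u * u + v * v) (odd-square i) (odd-square j))) eq)
                  (odd-squares-sum-not-square (2 * (i * i + i)) (2 * (j * j + j)) z)
  ... | odd i  | even j = descent-odd-even {k = j} (i , refl) (λ j≡0 → y≢0 (cong (2 *_) j≡0)) cop eq
  ... | even i | odd j  =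
    descent-odd-even {k = i} (j , refl) (λ i≡0 → x≢0 (cong (2 *_) i≡0)) (Coprime.sym cop)
                     (trans (+-comm (y * y * (y * y)) _) eq)

  no-primitive-solution : ∀ z → ¬ PrimitiveSolution z
  no-primitive-solution = <-rec _ λ z ih s → let z' , z'<z , s' = descent s in ih z'<z s'

  fourth-power-* : ∀ a g → a * g * (a * g) * (a * g * (a * g)) ≡ g * g * (g * g) * (a * a * (a * a))
  fourth-power-* a g =
    trans (cong₂ _*_ square-* square-*)
          (trans ([m*n]*[o*p]≡[m*o]*[n*p] (a * a) (g * g) (a * a) (g * g))
                 (*-comm (a * a * (a * a)) (g * g * (g * g))))
    where square-* = [m*n]*[o*p]≡[m*o]*[n*p] a g a g

  quartic-factor : ∀ a b g →
    a * g * (a * g) * (a * g * (a * g)) + b * g * (b * g) * (b * g * (b * g)) ≡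
    g * g * (g * g) * (a * a * (a * a) + b * b * (b * b))
  quartic-factor a b g = trans (cong₂ _+_ (fourth-power-* a g) (fourth-power-* b g))
                               (sym (*-distribˡ-+ (g * g * (g * g)) _ _))

  quartic-sum-not-square : ∀ {x y} → x ≢ 0 → y ≢ 0 → ¬ IsSquare (x * x * (x * x) + y * y * (y * y))
  quartic-sum-not-square {x} {y} x≢0 y≢0 square with gcd-decomposition x y y≢0
  ... | g , a , b , g≢0 , refl , refl , coprime-ab =
    let c , c²≡a⁴+b⁴ = square-cancelˡ g²≢0 (subst IsSquare (quartic-factor a b g) square)
    in no-primitive-solution c (solution a≢0 b≢0 coprime-ab (sym c²≡a⁴+b⁴))
    where
    g²≢0 : g * g ≢ 0
    g²≢0 g²≡0 = g≢0 (m*n≡0⇒m≡0 g g {{≢-nonZero g≢0}} g²≡0)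
    a≢0 : a ≢ 0
    a≢0 refl = x≢0 refl
    b≢0 : b ≢ 0
    b≢0 refl = y≢0 refl

module RationalQuartic where

  open FermatQuartic using (IsSquare; square-cancelˡ; quartic-sum-not-square)
  open import Data.Nat.Base as ℕ using (zero; suc)
  import Data.Nat.Properties as ℕ
  open import Data.Integer.Base as ℤ using (ℤ; +_; -[1+_]; ∣_∣)
  import Data.Integer.Properties as ℤ
  open import Data.Rational.Base hiding (∣_∣; _≥_)
  open import Data.Rational.Properties
  import Data.Rational.Unnormalised.Base as ℚᵘ
  import Data.Rational.Unnormalised.Properties as ℚᵘ
  import Tactic.RingSolver.Core.AlmostCommutativeRing as ACR
  open import Tactic.RingSolver using (solve-∀)
  open import Data.Product using (_,_)
  open import Data.Sum using (inj₁; inj₂)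
  open import Relation.Binary.PropositionalEquality hiding ([_])
  open import Relation.Nullary using (yes; no)
  open import Relation.Nullary.Decidable using (dec⇒maybe)

  ℚ-ring : ACR.AlmostCommutativeRing _ _
  ℚ-ring = ACR.fromCommutativeRing +-*-commutativeRing (λ p → dec⇒maybe (0ℚ ≟ p))

  fromℤ : ℤ → ℚ
  fromℤ i = i / 1

  fromℕ : ℕ → ℚ
  fromℕ n = fromℤ (+ n)

  toℚᵘ-fromℤ : ∀ i → toℚᵘ (fromℤ i) ℚᵘ.≃ ℚᵘ.mkℚᵘ i 0
  toℚᵘ-fromℤ i = toℚᵘ-fromℚᵘ (ℚᵘ.mkℚᵘ i 0)

  fromℤ-homo-* : ∀ i j → fromℤ (i ℤ.* j) ≡ fromℤ i * fromℤ j
  fromℤ-homo-* i j = toℚᵘ-injective (ℚᵘ.≃-trans (toℚᵘ-fromℤ (i ℤ.* j)) (ℚᵘ.≃-sym (begin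
    toℚᵘ (fromℤ i * fromℤ j)           ≈⟨ toℚᵘ-homo-* (fromℤ i) (fromℤ j) ⟩
    toℚᵘ (fromℤ i) ℚᵘ.* toℚᵘ (fromℤ j) ≈⟨ ℚᵘ.*-cong (toℚᵘ-fromℤ i) (toℚᵘ-fromℤ j) ⟩
    ℚᵘ.mkℚᵘ (i ℤ.* j) 0                ∎)))
    where open ℚᵘ.≃-Reasoning

  fromℤ-homo-+ : ∀ i j → fromℤ (i ℤ.+ j) ≡ fromℤ i + fromℤ j
  fromℤ-homo-+ i j = toℚᵘ-injective (ℚᵘ.≃-trans (toℚᵘ-fromℤ (i ℤ.+ j)) (ℚᵘ.≃-sym (begin
    toℚᵘ (fromℤ i + fromℤ j)           ≈⟨ toℚᵘ-homo-+ (fromℤ i) (fromℤ j) ⟩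
    toℚᵘ (fromℤ i) ℚᵘ.+ toℚᵘ (fromℤ j) ≈⟨ ℚᵘ.+-cong (toℚᵘ-fromℤ i) (toℚᵘ-fromℤ j) ⟩
    ℚᵘ.mkℚᵘ i 0 ℚᵘ.+ ℚᵘ.mkℚᵘ j 0
      ≈⟨ ℚᵘ.*≡* (cong (ℤ._* + 1) (cong₂ ℤ._+_ (ℤ.*-identityʳ i) (ℤ.*-identityʳ j))) ⟩
    ℚᵘ.mkℚᵘ (i ℤ.+ j) 0                ∎)))
    where open ℚᵘ.≃-Reasoning

  fromℤ-injective : ∀ {i j} → fromℤ i ≡ fromℤ j → i ≡ j
  fromℤ-injective {i} {j} eq
    with ℚᵘ.≃-trans (ℚᵘ.≃-sym (toℚᵘ-fromℤ i)) (ℚᵘ.≃-trans (toℚᵘ-cong eq) (toℚᵘ-fromℤ j))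
  ... | ℚᵘ.*≡* i*1≡j*1 = trans (sym (ℤ.*-identityʳ i)) (trans i*1≡j*1 (ℤ.*-identityʳ j))

  *-↧≡↥ : ∀ p → p * fromℤ (↧ p) ≡ fromℤ (↥ p)
  *-↧≡↥ p@(mkℚ n d _) = toℚᵘ-injective (begin
    toℚᵘ (p * fromℤ (↧ p))              ≈⟨ toℚᵘ-homo-* p (fromℤ (↧ p)) ⟩
    toℚᵘ p ℚᵘ.* toℚᵘ (fromℤ (↧ p))      ≈⟨ ℚᵘ.*-congˡ {toℚᵘ p} (toℚᵘ-fromℤ (↧ p)) ⟩
    toℚᵘ p ℚᵘ.* ℚᵘ.mkℚᵘ (↧ p) 0
      ≈⟨ ℚᵘ.*≡* (trans (ℤ.*-identityʳ _) (cong (λ k → n ℤ.* + k) (sym (ℕ.*-identityʳ (suc d))))) ⟩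
    ℚᵘ.mkℚᵘ (↥ p) 0                    ≈⟨ toℚᵘ-fromℤ (↥ p) ⟨
    toℚᵘ (fromℤ (↥ p))                 ∎)
    where open ℚᵘ.≃-Reasoning

  fromℕ-homo-* : ∀ m n → fromℕ (m ℕ.* n) ≡ fromℕ m * fromℕ n
  fromℕ-homo-* m n = trans (cong fromℤ (ℤ.pos-* m n)) (fromℤ-homo-* (+ m) (+ n))

  fromℕ-homo-+ : ∀ m n → fromℕ (m ℕ.+ n) ≡ fromℕ m + fromℕ n
  fromℕ-homo-+ m n = trans (cong fromℤ (ℤ.pos-+ m n)) (fromℤ-homo-+ (+ m) (+ n))

  fromℕ-injective : ∀ {m n} → fromℕ m ≡ fromℕ n → m ≡ n
  fromℕ-injective eq = ℤ.+-injective (fromℤ-injective eq)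

  fromℕ-≢0 : ∀ {n} → n ≢ 0 → fromℕ n ≢ 0ℚ
  fromℕ-≢0 n≢0 eq = n≢0 (fromℕ-injective eq)

  i*i≡∣i∣*∣i∣ : ∀ i → i ℤ.* i ≡ + (∣ i ∣ ℕ.* ∣ i ∣)
  i*i≡∣i∣*∣i∣ (+ n) = sym (ℤ.pos-* n n)
  i*i≡∣i∣*∣i∣ -[1+ n ] = refl

  ∣↥p∣≢0 : ∀ {p} → p ≢ 0ℚ → ∣ ↥ p ∣ ≢ 0
  ∣↥p∣≢0 {p} p≢0 ∣↥p∣≡0 = p≢0 (↥p≡0⇒p≡0 p (ℤ.∣i∣≡0⇒i≡0 ∣↥p∣≡0))

  [p*q]*[p*q]≡[p*p]*[q*q] : ∀ p q → (p * q) * (p * q) ≡ (p * p) * (q * q)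
  [p*q]*[p*q]≡[p*p]*[q*q] = solve-∀ ℚ-ring

  square-*-↧≡↥ : ∀ p → p * p * fromℕ (↧ₙ p ℕ.* ↧ₙ p) ≡ fromℕ (∣ ↥ p ∣ ℕ.* ∣ ↥ p ∣)
  square-*-↧≡↥ p = begin
    p * p * fromℕ (↧ₙ p ℕ.* ↧ₙ p)          ≡⟨ cong (p * p *_) (fromℕ-homo-* (↧ₙ p) (↧ₙ p)) ⟩
    p * p * (fromℤ (↧ p) * fromℤ (↧ p))    ≡⟨ [p*q]*[p*q]≡[p*p]*[q*q] p (fromℤ (↧ p)) ⟨
    (p * fromℤ (↧ p)) * (p * fromℤ (↧ p))  ≡⟨ cong₂ _*_ (*-↧≡↥ p) (*-↧≡↥ p) ⟩
    fromℤ (↥ p) * fromℤ (↥ p)              ≡⟨ fromℤ-homo-* (↥ p) (↥ p) ⟨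
    fromℤ (↥ p ℤ.* ↥ p)                    ≡⟨ cong fromℤ (i*i≡∣i∣*∣i∣ (↥ p)) ⟩
    fromℕ (∣ ↥ p ∣ ℕ.* ∣ ↥ p ∣)            ∎
    where open ≡-Reasoning

  scaled-square-*-↧≡↥ : ∀ p e →
    fromℕ ((∣ ↥ p ∣ ℕ.* e) ℕ.* (∣ ↥ p ∣ ℕ.* e)) ≡ p * p * fromℕ ((↧ₙ p ℕ.* e) ℕ.* (↧ₙ p ℕ.* e))
  scaled-square-*-↧≡↥ p e = begin
    fromℕ ((n ℕ.* e) ℕ.* (n ℕ.* e))               ≡⟨ cong fromℕ (ℕ.[m*n]*[o*p]≡[m*o]*[n*p] n e n e) ⟩
    fromℕ ((n ℕ.* n) ℕ.* (e ℕ.* e))               ≡⟨ fromℕ-homo-* (n ℕ.* n) (e ℕ.* e) ⟩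
    fromℕ (n ℕ.* n) * fromℕ (e ℕ.* e)             ≡⟨ cong (_* fromℕ (e ℕ.* e)) (square-*-↧≡↥ p) ⟨
    p * p * fromℕ (d ℕ.* d) * fromℕ (e ℕ.* e)     ≡⟨ *-assoc (p * p) _ _ ⟩
    p * p * (fromℕ (d ℕ.* d) * fromℕ (e ℕ.* e))   ≡⟨ cong (p * p *_) (fromℕ-homo-* (d ℕ.* d) (e ℕ.* e)) ⟨
    p * p * fromℕ ((d ℕ.* d) ℕ.* (e ℕ.* e))
      ≡⟨ cong (λ m → p * p * fromℕ m) (ℕ.[m*n]*[o*p]≡[m*o]*[n*p] d e d e) ⟨
    p * p * fromℕ ((d ℕ.* e) ℕ.* (d ℕ.* e))       ∎
    where
    open ≡-Reasoning
    n = ∣ ↥ p ∣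
    d = ↧ₙ p

  ℚ-square⇒square : ∀ {w n} → w * w ≡ fromℕ n → IsSquare n
  ℚ-square⇒square {w} {n} eq = square-cancelˡ {↧ₙ w} (λ ()) (∣ ↥ w ∣ , fromℕ-injective (begin
    fromℕ (∣ ↥ w ∣ ℕ.* ∣ ↥ w ∣)          ≡⟨ square-*-↧≡↥ w ⟨
    w * w * fromℕ (d ℕ.* d)              ≡⟨ cong (_* fromℕ (d ℕ.* d)) eq ⟩
    fromℕ n * fromℕ (d ℕ.* d)            ≡⟨ fromℕ-homo-* n (d ℕ.* d) ⟨
    fromℕ (n ℕ.* (d ℕ.* d))              ≡⟨ cong fromℕ (ℕ.*-comm n (d ℕ.* d)) ⟩
    fromℕ (d ℕ.* d ℕ.* n)                ∎))
    where
    open ≡-Reasoning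
    d = ↧ₙ w

  sum-of-squares-scale : ∀ P Q E → (P * P + Q * Q) * (E * E) ≡ (P * E) * (P * E) + (Q * E) * (Q * E)
  sum-of-squares-scale = solve-∀ ℚ-ring

  -- Multiplying w by the square of the common denominator of p² and q² gives a natural solution.
  ℚ-quartic-sum-not-square : ∀ w p q → p ≢ 0ℚ → q ≢ 0ℚ → w * w ≢ p * p * (p * p) + q * q * (q * q)
  ℚ-quartic-sum-not-square w p q p≢0 q≢0 eq =
    quartic-sum-not-square a≢0 b≢0 (ℚ-square⇒square {w * E} (begin
      (w * E) * (w * E)                                 ≡⟨ [p*q]*[p*q]≡[p*p]*[q*q] w E ⟩
      w * w * (E * E)                                   ≡⟨ cong (_* (E * E)) eq ⟩
      (p * p * (p * p) + q * q * (q * q)) * (E * E)     ≡⟨ sum-of-squares-scale (p * p) (q * q) E ⟩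
      p * p * E * (p * p * E) + q * q * E * (q * q * E) ≡⟨ cong₂ (λ u v → u * u + v * v) a²≡ b²≡ ⟨
      fromℕ (a ℕ.* a) * fromℕ (a ℕ.* a) + fromℕ (b ℕ.* b) * fromℕ (b ℕ.* b)
        ≡⟨ cong₂ _+_ (fromℕ-homo-* (a ℕ.* a) (a ℕ.* a)) (fromℕ-homo-* (b ℕ.* b) (b ℕ.* b)) ⟨
      fromℕ (a ℕ.* a ℕ.* (a ℕ.* a)) + fromℕ (b ℕ.* b ℕ.* (b ℕ.* b))
        ≡⟨ fromℕ-homo-+ (a ℕ.* a ℕ.* (a ℕ.* a)) (b ℕ.* b ℕ.* (b ℕ.* b)) ⟨
      fromℕ (a ℕ.* a ℕ.* (a ℕ.* a) ℕ.+ b ℕ.* b ℕ.* (b ℕ.* b)) ∎))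
    where
    open ≡-Reasoning
    a = ∣ ↥ p ∣ ℕ.* ↧ₙ q
    b = ∣ ↥ q ∣ ℕ.* ↧ₙ p
    D = ↧ₙ p ℕ.* ↧ₙ q
    E = fromℕ (D ℕ.* D)
    a²≡ : fromℕ (a ℕ.* a) ≡ p * p * E
    a²≡ = scaled-square-*-↧≡↥ p (↧ₙ q)
    b²≡ : fromℕ (b ℕ.* b) ≡ q * q * E
    b²≡ = trans (scaled-square-*-↧≡↥ q (↧ₙ p))
                (cong (λ m → q * q * fromℕ (m ℕ.* m)) (ℕ.*-comm (↧ₙ q) (↧ₙ p)))
    a≢0 : a ≢ 0
    a≢0 a≡0 = ∣↥p∣≢0 p≢0 (ℕ.m*n≡0⇒m≡0 _ (↧ₙ q) a≡0)
    b≢0 : b ≢ 0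
    b≢0 b≡0 = ∣↥p∣≢0 q≢0 (ℕ.m*n≡0⇒m≡0 _ (↧ₙ p) b≡0)

  2-not-square : ¬ IsSquare 2
  2-not-square (zero , ())
  2-not-square (suc zero , ())
  2-not-square (suc (suc c) , eq) = ℕ.m+1+n≢0 c (ℕ.suc-injective (ℕ.suc-injective eq))

  √2-irrational : ∀ p → fromℕ 2 * (p * p) ≢ 1ℚ
  √2-irrational p eq = 2-not-square (ℚ-square⇒square {fromℕ 2 * p} (begin
    (fromℕ 2 * p) * (fromℕ 2 * p)   ≡⟨ [p*q]*[p*q]≡[p*p]*[q*q] (fromℕ 2) p ⟩
    fromℕ 2 * fromℕ 2 * (p * p)     ≡⟨ *-assoc (fromℕ 2) (fromℕ 2) (p * p) ⟩
    fromℕ 2 * (fromℕ 2 * (p * p))   ≡⟨ cong (fromℕ 2 *_) eq ⟩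
    fromℕ 2 * 1ℚ                    ≡⟨ *-identityʳ (fromℕ 2) ⟩
    fromℕ 2                         ∎))
    where open ≡-Reasoning

  p*p+1≢0 : ∀ p → p * p + 1ℚ ≢ 0ℚ
  p*p+1≢0 p eq =
    ℕ.≢-nonZero⁻¹ (d ℕ.* d) {{ℕ.m*n≢0 d d}} (ℕ.m+n≡0⇒n≡0 (n ℕ.* n) (fromℕ-injective {n = 0} (begin
      fromℕ (n ℕ.* n ℕ.+ d ℕ.* d)              ≡⟨ fromℕ-homo-+ (n ℕ.* n) (d ℕ.* d) ⟩
      fromℕ (n ℕ.* n) + D                      ≡⟨ cong (_+ D) (square-*-↧≡↥ p) ⟨
      p * p * D + D                            ≡⟨ cong (λ u → p * p * D + u) (*-identityˡ D) ⟨
      p * p * D + 1ℚ * D                       ≡⟨ *-distribʳ-+ D (p * p) 1ℚ ⟨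
      (p * p + 1ℚ) * D                         ≡⟨ cong (_* D) eq ⟩
      0ℚ * D                                   ≡⟨ *-zeroˡ D ⟩
      0ℚ                                       ∎)))
    where
    open ≡-Reasoning
    n = ∣ ↥ p ∣
    d = ↧ₙ p
    D = fromℕ (d ℕ.* d)

  p*q≡0⇒p≡0∨q≡0 : ∀ p q → p * q ≡ 0ℚ → p ≡ 0ℚ ⊎ q ≡ 0ℚ
  p*q≡0⇒p≡0∨q≡0 p q pq≡0 with p ≟ 0ℚ
  ... | yes p≡0 = inj₁ p≡0
  ... | no p≢0 = inj₂ (begin
    q                ≡⟨ *-identityˡ q ⟨
    1ℚ * q           ≡⟨ cong (_* q) (*-inverseˡ p) ⟨
    1/ p * p * q     ≡⟨ *-assoc (1/ p) p q ⟩
    1/ p * (p * q)   ≡⟨ cong (1/ p *_) pq≡0 ⟩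
    1/ p * 0ℚ        ≡⟨ *-zeroʳ (1/ p) ⟩
    0ℚ               ∎)
    where
    open ≡-Reasoning
    instance
      _ : NonZero p
      _ = ≢-nonZero p≢0

module NormOfℚ√2 where

  open RationalQuartic
  open import Data.Rational.Base using (_+_; _*_; _-_; -_; 1ℚ)
  open import Data.Rational.Properties
    using (_≟_; +-identityˡ; +-identityʳ; +-inverseʳ; *-zeroˡ; *-zeroʳ; +-0-group)
  open import Algebra.Properties.Group +-0-group using (x∙y⁻¹≈ε⇒x≈y; ⁻¹-involutive; ε⁻¹≈ε)
  open import Tactic.RingSolver using (solve-∀)
  open import Data.Product using (_,_; proj₁; proj₂)
  open import Data.Sum using ([_,_]′; map)
  open import Relation.Binary.PropositionalEquality hiding ([_])
  open import Relation.Nullary using (Dec; yes; no; contradiction)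

  norm : ℚ√2 → ℚ
  norm u = re u * re u - fromℕ 2 * (im u * im u)

  brahmagupta : ∀ a b c d →
    (a * c + fromℕ 2 * (b * d)) * (a * c + fromℕ 2 * (b * d)) - fromℕ 2 * ((a * d + b * c) * (a * d + b * c)) ≡
    (a * a - fromℕ 2 * (b * b)) * (c * c - fromℕ 2 * (d * d))
  brahmagupta = solve-∀ ℚ-ring

  norm-⊛ : ∀ u v → norm (u ⊛ v) ≡ norm u * norm v
  norm-⊛ u v = brahmagupta (re u) (im u) (re v) (im v)

  norm-square : ∀ Y {R} → Y ⊛ Y ≡ R → norm Y * norm Y ≡ norm R
  norm-square Y refl = sym (norm-⊛ Y Y)

  ι-⊛-ι : ∀ a b → ι a ⊛ ι b ≡ ι (a * b)
  ι-⊛-ι a b = cong₂ _+_√2 (re-part a b) (im-part a b)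
    where
    re-part : ∀ a b → a * b + fromℕ 2 * (0ℚ * 0ℚ) ≡ a * b
    re-part = solve-∀ ℚ-ring
    im-part : ∀ a b → a * 0ℚ + 0ℚ * b ≡ 0ℚ
    im-part = solve-∀ ℚ-ring

  √2-⊛-ι : ∀ a → √2 ⊛ ι a ≡ _+_√2 0ℚ a
  √2-⊛-ι a = cong₂ _+_√2 (re-part a) (im-part a)
    where
    re-part : ∀ a → 0ℚ * a + fromℕ 2 * (1ℚ * 0ℚ) ≡ 0ℚ
    re-part = solve-∀ ℚ-ring
    im-part : ∀ a → 0ℚ * 0ℚ + 1ℚ * a ≡ a
    im-part = solve-∀ ℚ-ring

  √2-multiple-⊛-ι : ∀ a b → _+_√2 0ℚ a ⊛ ι b ≡ _+_√2 0ℚ (a * b)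
  √2-multiple-⊛-ι a b = cong₂ _+_√2 (re-part a b) (im-part a b)
    where
    re-part : ∀ a b → 0ℚ * b + fromℕ 2 * (a * 0ℚ) ≡ 0ℚ
    re-part = solve-∀ ℚ-ring
    im-part : ∀ a b → 0ℚ * 0ℚ + a * b ≡ a * b
    im-part = solve-∀ ℚ-ring

  ι-⊖-√2-multiple-⊕-ι : ∀ a b c → ι a ⊖ _+_√2 0ℚ b ⊕ ι c ≡ _+_√2 (a + c) (- b)
  ι-⊖-√2-multiple-⊕-ι a b c = cong₂ _+_√2 (re-part a c) (im-part b)
    where
    re-part : ∀ a c → a + - 0ℚ + c ≡ a + c
    re-part = solve-∀ ℚ-ring
    im-part : ∀ b → 0ℚ + - b + 0ℚ ≡ - b
    im-part = solve-∀ ℚ-ring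

  √2-multiple-⊖-⊕-𝟙 : ∀ p q d → _+_√2 p q ⊖ _+_√2 0ℚ d ⊕ 𝟙 ≡ _+_√2 (p + 1ℚ) (q - d)
  √2-multiple-⊖-⊕-𝟙 p q d = cong₂ _+_√2 (re-part p) (im-part q d)
    where
    re-part : ∀ p → p + - 0ℚ + 1ℚ ≡ p + 1ℚ
    re-part = solve-∀ ℚ-ring
    im-part : ∀ q d → q + - d + 0ℚ ≡ q - d
    im-part = solve-∀ ℚ-ring

  law-of-cosines-form : ∀ x y →
    ι x ⊛ ι x ⊖ √2 ⊛ ι x ⊛ ι y ⊕ ι y ⊛ ι y ≡ _+_√2 (x * x + y * y) (- (x * y))
  law-of-cosines-form x y = begin
    ι x ⊛ ι x ⊖ √2 ⊛ ι x ⊛ ι y ⊕ ι y ⊛ ι y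
      ≡⟨ cong₂ (λ u v → u ⊖ √2 ⊛ ι x ⊛ ι y ⊕ v) (ι-⊛-ι x x) (ι-⊛-ι y y) ⟩
    ι (x * x) ⊖ √2 ⊛ ι x ⊛ ι y ⊕ ι (y * y)
      ≡⟨ cong (λ u → ι (x * x) ⊖ u ⊛ ι y ⊕ ι (y * y)) (√2-⊛-ι x) ⟩
    ι (x * x) ⊖ _+_√2 0ℚ x ⊛ ι y ⊕ ι (y * y)
      ≡⟨ cong (λ u → ι (x * x) ⊖ u ⊕ ι (y * y)) (√2-multiple-⊛-ι x y) ⟩
    ι (x * x) ⊖ _+_√2 0ℚ (x * y) ⊕ ι (y * y)
      ≡⟨ ι-⊖-√2-multiple-⊕-ι (x * x) (x * y) (y * y) ⟩
    _+_√2 (x * x + y * y) (- (x * y))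
      ∎
    where open ≡-Reasoning

  norm-law-of-cosines : ∀ x y →
    norm (ι x ⊛ ι x ⊖ √2 ⊛ ι x ⊛ ι y ⊕ ι y ⊛ ι y) ≡ x * x * (x * x) + y * y * (y * y)
  norm-law-of-cosines x y = trans (cong norm (law-of-cosines-form x y)) (identity x y)
    where
    identity : ∀ x y →
      (x * x + y * y) * (x * x + y * y) - fromℕ 2 * ((- (x * y)) * (- (x * y))) ≡
      x * x * (x * x) + y * y * (y * y)
    identity = solve-∀ ℚ-ring

  curveRHS-ι : ∀ X →
    curveRHS (ι X) ≡ _+_√2 (X * X * X * X + fromℕ 2 * (X * X) + 1ℚ) (- (X * X * X) - X)
  curveRHS-ι X = begin
    curveRHS (ι X)
      ≡⟨ cong₂ (λ u v → u ⊖ √2 ⊛ v ⊕ ιℕ 2 ⊛ (ι X ⊛ ι X) ⊖ √2 ⊛ ι X ⊕ 𝟙) X⁴ X³ ⟩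
    ι (X * X * X * X) ⊖ √2 ⊛ ι (X * X * X) ⊕ ιℕ 2 ⊛ (ι X ⊛ ι X) ⊖ √2 ⊛ ι X ⊕ 𝟙
      ≡⟨ cong (λ u → ι (X * X * X * X) ⊖ √2 ⊛ ι (X * X * X) ⊕ u ⊖ √2 ⊛ ι X ⊕ 𝟙)
              (trans (cong (ιℕ 2 ⊛_) X²) (ι-⊛-ι (fromℕ 2) (X * X))) ⟩
    ι (X * X * X * X) ⊖ √2 ⊛ ι (X * X * X) ⊕ ι (fromℕ 2 * (X * X)) ⊖ √2 ⊛ ι X ⊕ 𝟙
      ≡⟨ cong₂ (λ u v → ι (X * X * X * X) ⊖ u ⊕ ι (fromℕ 2 * (X * X)) ⊖ v ⊕ 𝟙)
               (√2-⊛-ι (X * X * X)) (√2-⊛-ι X) ⟩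
    ι (X * X * X * X) ⊖ _+_√2 0ℚ (X * X * X) ⊕ ι (fromℕ 2 * (X * X)) ⊖ _+_√2 0ℚ X ⊕ 𝟙
      ≡⟨ cong (λ u → u ⊖ _+_√2 0ℚ X ⊕ 𝟙)
              (ι-⊖-√2-multiple-⊕-ι (X * X * X * X) (X * X * X) (fromℕ 2 * (X * X))) ⟩
    _+_√2 (X * X * X * X + fromℕ 2 * (X * X)) (- (X * X * X)) ⊖ _+_√2 0ℚ X ⊕ 𝟙
      ≡⟨ √2-multiple-⊖-⊕-𝟙 (X * X * X * X + fromℕ 2 * (X * X)) (- (X * X * X)) X ⟩
    _+_√2 (X * X * X * X + fromℕ 2 * (X * X) + 1ℚ) (- (X * X * X) - X)
      ∎
    where
    open ≡-Reasoning
    X² : ι X ⊛ ι X ≡ ι (X * X)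
    X² = ι-⊛-ι X X
    X³ : ι X ⊛ ι X ⊛ ι X ≡ ι (X * X * X)
    X³ = trans (cong (_⊛ ι X) X²) (ι-⊛-ι (X * X) X)
    X⁴ : ι X ⊛ ι X ⊛ ι X ⊛ ι X ≡ ι (X * X * X * X)
    X⁴ = trans (cong (_⊛ ι X) X³) (ι-⊛-ι (X * X * X) X)

  norm-curveRHS : ∀ X →
    norm (curveRHS (ι X)) ≡ (X * X + 1ℚ) * (X * X + 1ℚ) * (X * X * (X * X) + 1ℚ)
  norm-curveRHS X = trans (cong norm (curveRHS-ι X)) (identity X)
    where
    identity : ∀ X →
      (X * X * X * X + fromℕ 2 * (X * X) + 1ℚ) * (X * X * X * X + fromℕ 2 * (X * X) + 1ℚ)
        - fromℕ 2 * ((- (X * X * X) - X) * (- (X * X * X) - X)) ≡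
      (X * X + 1ℚ) * (X * X + 1ℚ) * (X * X * (X * X) + 1ℚ)
    identity = solve-∀ ℚ-ring

  p*p≡1⇒p≡1∨p≡-1 : ∀ p → p * p ≡ 1ℚ → p ≡ 1ℚ ⊎ p ≡ - 1ℚ
  p*p≡1⇒p≡1∨p≡-1 p p²≡1 =
    map (x∙y⁻¹≈ε⇒x≈y p 1ℚ)
        (λ p+1≡0 → x∙y⁻¹≈ε⇒x≈y p (- 1ℚ) (trans (cong (p +_) (⁻¹-involutive 1ℚ)) p+1≡0))
        (p*q≡0⇒p≡0∨q≡0 (p - 1ℚ) (p + 1ℚ) [p-1]*[p+1]≡0)
    where
    open ≡-Reasoning
    difference-of-squares : ∀ p → (p - 1ℚ) * (p + 1ℚ) ≡ p * p - 1ℚ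
    difference-of-squares = solve-∀ ℚ-ring
    [p-1]*[p+1]≡0 : (p - 1ℚ) * (p + 1ℚ) ≡ 0ℚ
    [p-1]*[p+1]≡0 = begin
      (p - 1ℚ) * (p + 1ℚ)   ≡⟨ difference-of-squares p ⟩
      p * p - 1ℚ            ≡⟨ cong (_- 1ℚ) p²≡1 ⟩
      1ℚ - 1ℚ               ≡⟨ +-inverseʳ 1ℚ ⟩
      0ℚ                    ∎

  square≡1-coordinates : ∀ a b → a * a + fromℕ 2 * (b * b) ≡ 1ℚ → a * b + b * a ≡ 0ℚ →
    (a ≡ 1ℚ ⊎ a ≡ - 1ℚ) × b ≡ 0ℚ
  square≡1-coordinates a b re≡1 im≡0 =
    [ (λ a≡0 → contradiction a≡0 a≢0) , (λ b≡0 → p*p≡1⇒p≡1∨p≡-1 a (a²≡1 b≡0) , b≡0) ]′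
      (p*q≡0⇒p≡0∨q≡0 a b ab≡0)
    where
    open ≡-Reasoning
    ab+ba≡2ab : ∀ a b → a * b + b * a ≡ fromℕ 2 * (a * b)
    ab+ba≡2ab = solve-∀ ℚ-ring
    ab≡0 : a * b ≡ 0ℚ
    ab≡0 = [ (λ 2≡0 → contradiction 2≡0 (fromℕ-≢0 {2} λ ())) , (λ ab≡0 → ab≡0) ]′
             (p*q≡0⇒p≡0∨q≡0 (fromℕ 2) (a * b) (trans (sym (ab+ba≡2ab a b)) im≡0))
    a≢0 : a ≢ 0ℚ
    a≢0 a≡0 = √2-irrational b (begin
      fromℕ 2 * (b * b)             ≡⟨ +-identityˡ _ ⟨
      0ℚ + fromℕ 2 * (b * b)        ≡⟨ cong (_+ fromℕ 2 * (b * b)) (*-zeroˡ 0ℚ) ⟨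
      0ℚ * 0ℚ + fromℕ 2 * (b * b)   ≡⟨ cong (λ a → a * a + fromℕ 2 * (b * b)) a≡0 ⟨
      a * a + fromℕ 2 * (b * b)     ≡⟨ re≡1 ⟩
      1ℚ                            ∎)
    a²≡1 : b ≡ 0ℚ → a * a ≡ 1ℚ
    a²≡1 b≡0 = begin
      a * a                         ≡⟨ +-identityʳ (a * a) ⟨
      a * a + 0ℚ                    ≡⟨ cong (a * a +_) (*-zeroʳ (fromℕ 2)) ⟨
      a * a + fromℕ 2 * 0ℚ          ≡⟨ cong (λ c → a * a + fromℕ 2 * c) (*-zeroˡ 0ℚ) ⟨
      a * a + fromℕ 2 * (0ℚ * 0ℚ)   ≡⟨ cong (λ b → a * a + fromℕ 2 * (b * b)) b≡0 ⟨
      a * a + fromℕ 2 * (b * b)     ≡⟨ re≡1 ⟩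
      1ℚ                            ∎

  square-roots-of-𝟙 : ∀ Y → Y ⊛ Y ≡ 𝟙 → Y ≡ 𝟙 ⊎ Y ≡ ⊝ 𝟙
  square-roots-of-𝟙 Y Y²≡1 =
    map (λ a≡1 → cong₂ _+_√2 a≡1 b≡0) (λ a≡-1 → cong₂ _+_√2 a≡-1 (trans b≡0 (sym ε⁻¹≈ε))) a≡±1
    where
    re-eq : re Y * re Y + fromℕ 2 * (im Y * im Y) ≡ 1ℚ
    re-eq = cong re Y²≡1
    im-eq : re Y * im Y + im Y * re Y ≡ 0ℚ
    im-eq = cong im Y²≡1
    a≡±1 = proj₁ (square≡1-coordinates (re Y) (im Y) re-eq im-eq)
    b≡0 = proj₂ (square≡1-coordinates (re Y) (im Y) re-eq im-eq)

  quartic-rescale : ∀ X c →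
    c * c * (c * c * (X * X * (X * X) + 1ℚ)) ≡ X * c * (X * c) * (X * c * (X * c)) + c * c * (c * c)
  quartic-rescale = solve-∀ ℚ-ring

  off-axis-not-on-curve : ∀ X Y → X ≢ 0ℚ → ¬ OnCurve X Y
  off-axis-not-on-curve X Y X≢0 on-curve =
    ℚ-quartic-sum-not-square (c * w) (X * c) c Xc≢0 c≢0 (begin
      c * w * (c * w)                                       ≡⟨ [p*q]*[p*q]≡[p*p]*[q*q] c w ⟩
      c * c * (w * w)                                       ≡⟨ cong (c * c *_) w²≡c²[X⁴+1] ⟩
      c * c * (c * c * (X * X * (X * X) + 1ℚ))              ≡⟨ quartic-rescale X c ⟩
      X * c * (X * c) * (X * c * (X * c)) + c * c * (c * c) ∎)
    where
    open ≡-Reasoning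
    c = X * X + 1ℚ
    w = norm Y
    w²≡c²[X⁴+1] : w * w ≡ c * c * (X * X * (X * X) + 1ℚ)
    w²≡c²[X⁴+1] = trans (norm-square Y on-curve) (norm-curveRHS X)
    c≢0 : c ≢ 0ℚ
    c≢0 = p*p+1≢0 X
    Xc≢0 : X * c ≢ 0ℚ
    Xc≢0 Xc≡0 = [ X≢0 , c≢0 ]′ (p*q≡0⇒p≡0∨q≡0 X c Xc≡0)

  on-curve-points : ∀ X Y → OnCurve X Y → X ≡ 0ℚ × (Y ≡ 𝟙 ⊎ Y ≡ ⊝ 𝟙)
  on-curve-points X Y on-curve = by-cases (X ≟ 0ℚ)
    where
    by-cases : Dec (X ≡ 0ℚ) → X ≡ 0ℚ × (Y ≡ 𝟙 ⊎ Y ≡ ⊝ 𝟙)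
    by-cases (yes X≡0) = X≡0 , square-roots-of-𝟙 Y (trans on-curve (cong (λ X → curveRHS (ι X)) X≡0))
    by-cases (no X≢0) = contradiction on-curve (off-axis-not-on-curve X Y X≢0)

  law-of-cosines-not-square : ∀ x y → x ≢ 0 → y ≢ 0 → ∀ z →
    z ⊛ z ≢ ιℕ x ⊛ ιℕ x ⊖ √2 ⊛ ιℕ x ⊛ ιℕ y ⊕ ιℕ y ⊛ ιℕ y
  law-of-cosines-not-square x y x≢0 y≢0 z eq =
    ℚ-quartic-sum-not-square (norm z) (fromℕ x) (fromℕ y) (fromℕ-≢0 x≢0) (fromℕ-≢0 y≢0)
      (trans (norm-square z eq) (norm-law-of-cosines (fromℕ x) (fromℕ y)))

open NormOfℚ√2 using (on-curve-points; law-of-cosines-not-square)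
open import Data.Nat.Properties using (m<n⇒n≢0)
open import Data.Product using (_,_)

mainTheorem4 :
    ((X : ℚ) (Y : ℚ√2) → OnCurve X Y → X ≡ 0ℚ × (Y ≡ 𝟙 ⊎ Y ≡ ⊝ 𝟙))
    × ((x y : ℕ) → x ≥ 1 → y ≥ 1 →
        ¬ (∃ λ (z₁ : ℚ√2) → ∃ λ (z₂ : ℚ√2) →
             (z₁ ⊛ z₁ ≡ ιℕ x ⊛ ιℕ x ⊖ √2 ⊛ ιℕ x ⊛ ιℕ y ⊕ ιℕ y ⊛ ιℕ y)
             × (z₂ ⊛ z₂ ≡ ιℕ x ⊛ ιℕ x ⊕ ιℕ y ⊛ ιℕ y)))
mainTheorem4 =
  on-curve-points ,
  λ x y x≥1 y≥1 (z₁ , _ , z₁²≡ , _) →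
    law-of-cosines-not-square x y (m<n⇒n≢0 x≥1) (m<n⇒n≢0 y≥1) z₁ z₁²≡
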